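{- For all positive integers $m$ and $n$, $\Lambda_m \Lambda_n$ divides $\Lambda_{mn}$, where $\Lambda_k = \operatorname{lcm}(1,2,\ldots,k)$.
   Context: $\Lambda_k$ denotes the least common multiple of $1,2,\ldots,k$. -}

module Defs where

open import Data.Nat using (ℕ; zero; suc)
open import Data.Nat.LCM using (lcm)

Λ : ℕ → ℕ
Λ zero    = 1
Λ (suc k) = lcm (suc k) (Λ k)

module Submission where

-- Λ k = lcm(1,…,k) is the least common multiple of 1,…,k, so a multiple of
-- Λ k is produced by checking divisibility by each i ≤ k separately.  The
-- proof uses this in a "scaled" form:
--   (1) every d with 1 ≤ d ≤ N divides Λ N;
--   (2) lcm a b * c ∣ X whenever a * c ∣ X and b * c ∣ X (for every c);
--   (3) iterating (2): Λ (k+1) * c ∣ X whenever i * c ∣ X for all 1 ≤ i ≤ k+1.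
-- For the theorem put X = Λ((m+1)(n+1)).  Any product i * j with
-- 1 ≤ i ≤ m+1 and 1 ≤ j ≤ n+1 is at most (m+1)(n+1), so it divides X by (1).
-- Applying (3) over j (with c = i) gives i * Λ(n+1) ∣ X for every such i, and
-- applying (3) once more over i (with c = Λ(n+1)) gives Λ(m+1) * Λ(n+1) ∣ X.

open import Defs
open import Data.Nat using (ℕ; zero; suc; _*_; _≤_; s≤s)
open import Data.Nat.Divisibility
open import Data.Nat.LCM using (lcm; m∣lcm[m,n]; n∣lcm[m,n]; lcm-least)
open import Data.Nat.Properties using (m≤n⇒m<n∨m≡n; *-comm; *-mono-≤; ≤-trans; ≤-reflexive; ≤-refl; n≤1+n)
open import Data.Sum using (inj₁; inj₂)
open import Relation.Binary.PropositionalEquality using (refl; subst)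

∣Λ : ∀ d N → suc d ≤ N → suc d ∣ Λ N
∣Λ d (suc N) (s≤s d≤N) with m≤n⇒m<n∨m≡n d≤N
... | inj₂ refl = m∣lcm[m,n] (suc N) (Λ N)
... | inj₁ d<N  = ∣-trans (∣Λ d N d<N) (n∣lcm[m,n] (suc N) (Λ N))

-- (2) The least-common-multiple property, scaled by an arbitrary factor c:
-- if X = q * c then a ∣ q and b ∣ q, hence lcm a b ∣ q.  For c = 0 the
-- hypothesis already says 0 ∣ X.
lcm*-least : ∀ c a b X → a * c ∣ X → b * c ∣ X → lcm a b * c ∣ X
lcm*-least zero a b X a*0∣X _ =
  subst (_∣ X) (*-comm 0 (lcm a b)) (subst (_∣ X) (*-comm a 0) a*0∣X)
lcm*-least c@(suc _) a b X a*c∣X b*c∣X with ∣-trans (n∣m*n a) a*c∣X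
... | divides-refl q =
  *-monoˡ-∣ c (lcm-least (*-cancelʳ-∣ {a} {q} c a*c∣X) (*-cancelʳ-∣ {b} {q} c b*c∣X))

Λ*-least : ∀ c X k → (∀ i → i ≤ k → suc i * c ∣ X) → Λ (suc k) * c ∣ X
Λ*-least c X zero    i*c∣X = lcm*-least c 1 1 X (i*c∣X 0 ≤-refl) (i*c∣X 0 ≤-refl)
Λ*-least c X (suc k) i*c∣X =
  lcm*-least c (suc (suc k)) (Λ (suc k)) X
    (i*c∣X (suc k) ≤-refl)
    (Λ*-least c X k (λ i i≤k → i*c∣X i (≤-trans i≤k (n≤1+n k))))

lemma2p3 : (m n : ℕ) → Λ (suc m) * Λ (suc n) ∣ Λ (suc m * suc n)
lemma2p3 m n = Λ*-least (Λ (suc n)) X m row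
  where
  X = Λ (suc m * suc n)

  product∣X : ∀ i j → i ≤ m → j ≤ n → suc j * suc i ∣ X
  product∣X i j i≤m j≤n = ∣Λ _ (suc m * suc n)
    (≤-trans (≤-reflexive (*-comm (suc j) (suc i))) (*-mono-≤ (s≤s i≤m) (s≤s j≤n)))

  row : ∀ i → i ≤ m → suc i * Λ (suc n) ∣ X
  row i i≤m = subst (_∣ X) (*-comm (Λ (suc n)) (suc i))
    (Λ*-least (suc i) X n (λ j j≤n → product∣X i j i≤m j≤n))
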